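{- Every 1-truth-table degree contains an $\mathrm{F_{REC}}$-compressible set.
   Context: $\Sigma=\{0,1\}$. $\mathrm{F_{REC}}$ is the class of total recursive functions $\Sigma^\ast\to\Sigma^\ast$. A function $f$ is a compression function for $A\subseteq\Sigma^\ast$ if $f$ is defined on all of $A$, $f(A)=\Sigma^\ast$, and $f$ is injective on $A$ (no condition outside $A$); $A$ is $\mathrm{F_{REC}}$-compressible if it has a compression function in $\mathrm{F_{REC}}$. $A\leq_{1\text{ - }tt}B$ means $A$ Turing reduces to $B$ via a recursive oracle machine halting on all inputs and making at most one query; 1-truth-table degrees are equivalence classes under mutual $\leq_{1\text{ - }tt}$-reducibility. -}

module Defs where

open import Data.Nat using (ℕ; zero; suc; _+_; _*_; _<_)
open import Data.Fin using (Fin)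
open import Data.Vec using (Vec; []; _∷_; lookup)
open import Data.Bool using (Bool; true; false; if_then_else_)
open import Data.List using (List; []; _∷_)
open import Data.Product using (Σ; ∃; _×_; _,_)
open import Relation.Binary.PropositionalEquality using (_≡_)

Word : Set
Word = List Bool

Lang : Set
Lang = Word → Bool

-- Standard bijection Σ* ≅ ℕ (bijective base-2 numeration).
code : Word → ℕ
code []          = 0
code (false ∷ w) = suc (2 * code w)
code (true  ∷ w) = suc (suc (2 * code w))

-- Partial recursive (μ-recursive) function terms of arity n.
data PR : ℕ → Set where
  Z    : ∀ {n} → PR n
  S    : PR 1
  P    : ∀ {n} → Fin n → PR n
  comp : ∀ {m n} → PR m → Vec (PR n) m → PR n
  prim : ∀ {n} → PR n → PR (suc (suc n)) → PR (suc n)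
  mu   : ∀ {n} → PR (suc n) → PR n

data Eval : ∀ {n} → PR n → Vec ℕ n → ℕ → Set
data EvalAll : ∀ {m n} → Vec (PR n) m → Vec ℕ n → Vec ℕ m → Set

data Eval where
  eZ     : ∀ {n} {xs : Vec ℕ n} → Eval Z xs 0
  eS     : ∀ {x} → Eval S (x ∷ []) (suc x)
  eP     : ∀ {n} {i : Fin n} {xs} → Eval (P i) xs (lookup xs i)
  eComp  : ∀ {m n} {f : PR m} {gs : Vec (PR n) m} {xs ys y} →
           EvalAll gs xs ys → Eval f ys y → Eval (comp f gs) xs y
  ePrim0 : ∀ {n} {g : PR n} {h} {xs y} →
           Eval g xs y → Eval (prim g h) (0 ∷ xs) y
  ePrimS : ∀ {n} {g : PR n} {h} {k xs r y} →
           Eval (prim g h) (k ∷ xs) r → Eval h (k ∷ r ∷ xs) y →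
           Eval (prim g h) (suc k ∷ xs) y
  eMu    : ∀ {n} {f : PR (suc n)} {xs y} →
           Eval f (y ∷ xs) 0 →
           (∀ z → z < y → ∃ λ k → Eval f (z ∷ xs) (suc k)) →
           Eval (mu f) xs y

data EvalAll where
  []  : ∀ {n} {xs : Vec ℕ n} → EvalAll [] xs []
  _∷_ : ∀ {m n} {g : PR n} {gs : Vec (PR n) m} {xs y ys} →
        Eval g xs y → EvalAll gs xs ys → EvalAll (g ∷ gs) xs (y ∷ ys)

Recursive : (Word → Word) → Set
Recursive f = Σ (PR 1) λ p → ∀ w → Eval p (code w ∷ []) (code (f w))

RecursiveBool : (Word → Bool) → Set
RecursiveBool g = Recursive (λ w → g w ∷ [])

-- On input x it computes the query q x, and outputs α x if q x ∈ B and
-- β x otherwise (α = β covers the case of no essential query).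
_≤1tt_ : Lang → Lang → Set
A ≤1tt B = Σ (Word → Word) λ q → Σ (Word → Bool) λ α → Σ (Word → Bool) λ β →
  Recursive q × RecursiveBool α × RecursiveBool β ×
  (∀ x → A x ≡ (if B (q x) then α x else β x))

IsCompression : (Word → Word) → Lang → Set
IsCompression f A =
  (∀ x y → A x ≡ true → A y ≡ true → f x ≡ f y → x ≡ y) ×
  (∀ y → ∃ λ x → A x ≡ true × f x ≡ y)

FREC-compressible : Lang → Set
FREC-compressible A = Σ (Word → Word) λ f → Recursive f × IsCompression f A

-- Let A = 0B ∪ 1B̄ (the letter 0 is false), i.e. A (0w) = B w and A (1w) = ¬ B w.  Then A ≤1tt B
-- (query the tail, answer according to the first letter) and B ≤1tt A
-- (query 0w).  For every w exactly one of 0w, 1w lies in A, so deleting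
-- the first letter is a bijection from A onto Σ*, i.e. a recursive
-- compression function.
module Submission where

open import Defs
open import Data.Product using (∃; _×_; _,_)
open import Data.Nat using (ℕ; zero; suc; _+_; _*_; _∸_; pred)
open import Data.Nat.Properties using (+-identityʳ; +-comm; *-suc; 0∸n≡0)
open import Data.Fin using (zero; suc)
open import Data.Vec using (Vec; []; _∷_)
open import Data.Bool using (Bool; true; false; not; if_then_else_)
open import Data.List using ([]; _∷_; drop)
open import Function using (_∘_; case_of_)
open import Relation.Binary.PropositionalEquality
  using (_≡_; refl; sym; trans; cong; subst; module ≡-Reasoning)

bit : Bool → ℕ
bit false = 0
bit true  = 1

code-∷ : ∀ b w → code (b ∷ w) ≡ suc (bit b + 2 * code w)
code-∷ false w = refl
code-∷ true  w = refl

code-[_] : ∀ b → code (b ∷ []) ≡ suc (bit b)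
code-[ false ] = refl
code-[ true  ] = refl

parity : ℕ → ℕ
parity zero    = 0
parity (suc n) = 1 ∸ parity n

half : ℕ → ℕ
half zero    = 0
half (suc n) = half n + parity n

parity-even : ∀ c → parity (2 * c) ≡ 0
parity-even zero = refl
parity-even (suc c) =
  trans (cong parity (*-suc 2 c)) (cong (λ p → 1 ∸ (1 ∸ p)) (parity-even c))

half-even : ∀ c → half (2 * c) ≡ c
half-even zero = refl
half-even (suc c) = begin
  half (2 * suc c)                              ≡⟨ cong half (*-suc 2 c) ⟩
  half (2 * c) + parity (2 * c) + (1 ∸ parity (2 * c))
    ≡⟨ cong (λ p → half (2 * c) + p + (1 ∸ p)) (parity-even c) ⟩
  half (2 * c) + 0 + 1                          ≡⟨ cong (λ h → h + 0 + 1) (half-even c) ⟩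
  c + 0 + 1                                     ≡⟨ cong (_+ 1) (+-identityʳ c) ⟩
  c + 1                                         ≡⟨ +-comm c 1 ⟩
  suc c                                         ∎
  where open ≡-Reasoning

parity-bit : ∀ b c → parity (bit b + 2 * c) ≡ bit b
parity-bit false c = parity-even c
parity-bit true  c = cong (1 ∸_) (parity-even c)

half-bit : ∀ b c → half (bit b + 2 * c) ≡ c
half-bit false c = half-even c
half-bit true  c = trans (cong (half (2 * c) +_) (parity-even c))
                          (trans (+-identityʳ _) (half-even c))

Computes : PR 1 → (ℕ → ℕ) → Set
Computes p g = ∀ n → Eval p (n ∷ []) (g n)

_∘ₚ_ : PR 1 → PR 1 → PR 1
q ∘ₚ p = comp q (p ∷ [])

computes-∘ : ∀ {p q g h} → Computes p g → Computes q h → Computes (q ∘ₚ p) (h ∘ g)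
computes-∘ {g = g} ⊢p ⊢q n = eComp (⊢p n ∷ []) (⊢q (g n))

computes⇒recursive : ∀ {p g} {f : Word → Word} →
  Computes p g → (∀ w → g (code w) ≡ code (f w)) → Recursive f
computes⇒recursive {p} ⊢p g∘code≗code∘f =
  p , λ w → subst (Eval p (code w ∷ [])) (g∘code≗code∘f w) (⊢p (code w))

computes⇒recursiveBool : ∀ {p g} {f : Word → Bool} →
  Computes p g → (∀ w → g (code w) ≡ suc (bit (f w))) → RecursiveBool f
computes⇒recursiveBool {f = f} ⊢p g∘code≗bit∘f =
  computes⇒recursive ⊢p λ w → trans (g∘code≗bit∘f w) (sym code-[ f w ])

S-computes : Computes S suc
S-computes _ = eS

constₚ : ∀ {n} → ℕ → PR n
constₚ zero    = Z
constₚ (suc k) = comp S (constₚ k ∷ [])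

constₚ-eval : ∀ {n} k {xs : Vec ℕ n} → Eval (constₚ k) xs k
constₚ-eval zero    = eZ
constₚ-eval (suc k) = eComp (constₚ-eval k ∷ []) eS

predₚ : PR 1
predₚ = prim Z (P zero)

predₚ-computes : Computes predₚ pred
predₚ-computes zero    = ePrim0 eZ
predₚ-computes (suc n) = ePrimS (predₚ-computes n) eP

monusₚ : PR 1
monusₚ = prim (constₚ 1) Z

monusₚ-computes : Computes monusₚ (1 ∸_)
monusₚ-computes zero    = ePrim0 (constₚ-eval 1)
monusₚ-computes (suc n) =
  subst (Eval monusₚ (suc n ∷ [])) (sym (0∸n≡0 n)) (ePrimS (monusₚ-computes n) eZ)

parityₚ : PR 1
parityₚ = prim Z (comp monusₚ (P (suc zero) ∷ []))

parityₚ-computes : Computes parityₚ parity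
parityₚ-computes zero    = ePrim0 eZ
parityₚ-computes (suc n) =
  ePrimS (parityₚ-computes n) (eComp (eP ∷ []) (monusₚ-computes (parity n)))

addₚ : PR 2
addₚ = prim (P zero) (comp S (P (suc zero) ∷ []))

addₚ-eval : ∀ m n → Eval addₚ (m ∷ n ∷ []) (m + n)
addₚ-eval zero    n = ePrim0 eP
addₚ-eval (suc m) n = ePrimS (addₚ-eval m n) (eComp (eP ∷ []) eS)

doubleₚ : PR 1
doubleₚ = comp addₚ (P zero ∷ P zero ∷ [])

doubleₚ-computes : Computes doubleₚ (2 *_)
doubleₚ-computes n =
  subst (Eval doubleₚ (n ∷ [])) (cong (n +_) (sym (+-identityʳ n)))
        (eComp (eP ∷ eP ∷ []) (addₚ-eval n n))

halfₚ : PR 1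
halfₚ = prim Z (comp addₚ (P (suc zero) ∷ comp parityₚ (P zero ∷ []) ∷ []))

halfₚ-computes : Computes halfₚ half
halfₚ-computes zero    = ePrim0 eZ
halfₚ-computes (suc n) =
  ePrimS (halfₚ-computes n)
         (eComp (eP ∷ eComp (eP ∷ []) (parityₚ-computes n) ∷ [])
                (addₚ-eval (half n) (parity n)))

startsWithFalse : Word → Bool
startsWithFalse []      = false
startsWithFalse (b ∷ _) = not b

startsWithTrue : Word → Bool
startsWithTrue []      = false
startsWithTrue (b ∷ _) = b

bit-not : ∀ b → bit (not b) ≡ 1 ∸ bit b
bit-not false = refl
bit-not true  = refl

drop1-recursive : Recursive (drop 1)
drop1-recursive = computes⇒recursive (computes-∘ predₚ-computes halfₚ-computes) half∘pred∘code
  where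
  half∘pred∘code : ∀ w → half (pred (code w)) ≡ code (drop 1 w)
  half∘pred∘code []      = refl
  half∘pred∘code (b ∷ w) = trans (cong (half ∘ pred) (code-∷ b w)) (half-bit b (code w))

consFalse-recursive : Recursive (false ∷_)
consFalse-recursive = computes⇒recursive {f = false ∷_} (computes-∘ doubleₚ-computes S-computes) (λ _ → refl)

startsWithFalse-recursive : RecursiveBool startsWithFalse
startsWithFalse-recursive =
  computes⇒recursiveBool (computes-∘ parityₚ-computes S-computes) (cong suc ∘ parity∘code)
  where
  parity∘code : ∀ w → parity (code w) ≡ bit (startsWithFalse w)
  parity∘code []      = refl
  parity∘code (b ∷ w) = begin
    parity (code (b ∷ w))         ≡⟨ cong parity (code-∷ b w) ⟩
    1 ∸ parity (bit b + 2 * code w) ≡⟨ cong (1 ∸_) (parity-bit b (code w)) ⟩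
    1 ∸ bit b                     ≡⟨ sym (bit-not b) ⟩
    bit (not b)                   ∎
    where open ≡-Reasoning

startsWithTrue-recursive : RecursiveBool startsWithTrue
startsWithTrue-recursive =
  computes⇒recursiveBool
    (computes-∘ (computes-∘ predₚ-computes parityₚ-computes) S-computes)
    (cong suc ∘ parity∘pred∘code)
  where
  parity∘pred∘code : ∀ w → parity (pred (code w)) ≡ bit (startsWithTrue w)
  parity∘pred∘code []      = refl
  parity∘pred∘code (b ∷ w) =
    trans (cong (parity ∘ pred) (code-∷ b w)) (parity-bit b (code w))

const-recursiveBool : ∀ b → RecursiveBool (λ _ → b)
const-recursiveBool b =
  computes⇒recursiveBool {f = λ _ → b} (λ _ → constₚ-eval (suc (bit b))) (λ _ → refl)

_⊕_ : Lang → Lang → Lang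
(A ⊕ C) []          = false
(A ⊕ C) (false ∷ w) = A w
(A ⊕ C) (true  ∷ w) = C w

∁ : Lang → Lang
∁ B = not ∘ B

≤1tt-⊕ˡ : ∀ A C → A ≤1tt (A ⊕ C)
≤1tt-⊕ˡ A C = false ∷_ , (λ _ → true) , (λ _ → false)
            , consFalse-recursive , const-recursiveBool true , const-recursiveBool false
            , answer
  where
  answer : ∀ w → A w ≡ (if A w then true else false)
  answer w with A w
  ... | true  = refl
  ... | false = refl

⊕∁-≤1tt : ∀ B → (B ⊕ ∁ B) ≤1tt B
⊕∁-≤1tt B = drop 1 , startsWithFalse , startsWithTrue
          , drop1-recursive , startsWithFalse-recursive , startsWithTrue-recursive
          , answer
  where
  answer : ∀ x → (B ⊕ ∁ B) x ≡ (if B (drop 1 x) then startsWithFalse x else startsWithTrue x)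
  answer x with B (drop 1 x) in Bw
  answer []          | true  = refl
  answer []          | false = refl
  answer (false ∷ w) | true  = Bw
  answer (false ∷ w) | false = Bw
  answer (true  ∷ w) | true  = cong not Bw
  answer (true  ∷ w) | false = cong not Bw

drop1-compresses-⊕∁ : ∀ B → IsCompression (drop 1) (B ⊕ ∁ B)
drop1-compresses-⊕∁ B = injective , surjective
  where
  injective : ∀ x y → (B ⊕ ∁ B) x ≡ true → (B ⊕ ∁ B) y ≡ true → drop 1 x ≡ drop 1 y → x ≡ y
  injective (false ∷ w) (false ∷ .w) _  _  refl = refl
  injective (true  ∷ w) (true  ∷ .w) _  _  refl = refl
  injective (false ∷ w) (true  ∷ .w) Bw ¬Bw refl with B w
  ... | true  = case ¬Bw of λ ()
  ... | false = case Bw of λ ()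
  injective (true  ∷ w) (false ∷ .w) ¬Bw Bw refl with B w
  ... | true  = case ¬Bw of λ ()
  ... | false = case Bw of λ ()
  surjective : ∀ y → ∃ λ x → (B ⊕ ∁ B) x ≡ true × drop 1 x ≡ y
  surjective y with B y in By
  ... | true  = false ∷ y , By , refl
  ... | false = true ∷ y , cong not By , refl

corollary17 : (B : Lang) → ∃ λ (A : Lang) → (A ≤1tt B) × (B ≤1tt A) × FREC-compressible A
corollary17 B =
  B ⊕ ∁ B , ⊕∁-≤1tt B , ≤1tt-⊕ˡ B (∁ B) , drop 1 , drop1-recursive , drop1-compresses-⊕∁ B
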